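{- Let $K$ and $L$ be fields, and assume that the multiplicative group $L^{\times}$ is a linear space over $K$. Then the characteristic of $K$ is $2$ or the characteristic of $L$ is $2$.
   Context: An abelian group $G$ (written multiplicatively) is said to be a linear space over a field $K$ if there is a scalar multiplication $K\times G\to G$ making $G$, with its group operation as vector addition, a vector space over $K$. -}

module Defs where

open import Level using (Level; _⊔_; suc)
open import Algebra.Bundles using (CommutativeRing)
open import Data.Product using (∃)
open import Data.Sum using (_⊎_)
open import Relation.Nullary using (¬_)

record Field (c ℓ : Level) : Set (suc (c ⊔ ℓ)) where
  field
    commutativeRing : CommutativeRing c ℓ
  open CommutativeRing commutativeRing public
  field
    0≉1     : ¬ (0# ≈ 1#)
    zero⊎inv : ∀ x → (x ≈ 0#) ⊎ (∃ λ y → x * y ≈ 1#)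

CharTwo : ∀ {c ℓ} → Field c ℓ → Set ℓ
CharTwo F = 1# + 1# ≈ 0#
  where open Field F

-- A scalar multiplication K × L^× → L^× making the multiplicative group
-- L^× = { x ∈ L | x ≠ 0 } (group operation = multiplication of L) a vector
-- space over K.  An element of L^× is a pair (x , proof that x ≉ 0);
-- equality on L^× is equality of the underlying elements of L.
record MultGroupLinearSpace {c₁ ℓ₁ c₂ ℓ₂} (K : Field c₁ ℓ₁) (L : Field c₂ ℓ₂)
       : Set (c₁ ⊔ ℓ₁ ⊔ c₂ ⊔ ℓ₂) where
  private
    module K = Field K
    module L = Field L
  field
    smul      : K.Carrier → (x : L.Carrier) → ¬ (x L.≈ L.0#) → L.Carrier
    smul-nz   : ∀ a x (px : ¬ (x L.≈ L.0#)) → ¬ (smul a x px L.≈ L.0#)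
    smul-cong : ∀ {a b x y} (px : ¬ (x L.≈ L.0#)) (py : ¬ (y L.≈ L.0#)) →
                a K.≈ b → x L.≈ y → smul a x px L.≈ smul b y py
    distrib-vec : ∀ a x y (px : ¬ (x L.≈ L.0#)) (py : ¬ (y L.≈ L.0#))
                  (pxy : ¬ ((x L.* y) L.≈ L.0#)) →
                  smul a (x L.* y) pxy L.≈ (smul a x px L.* smul a y py)
    distrib-scal : ∀ a b x (px : ¬ (x L.≈ L.0#)) →
                   smul (a K.+ b) x px L.≈ (smul a x px L.* smul b x px)
    assoc : ∀ a b x (px : ¬ (x L.≈ L.0#)) →
            smul (a K.* b) x px L.≈ smul a (smul b x px) (smul-nz b x px)
    identity : ∀ x (px : ¬ (x L.≈ L.0#)) → smul K.1# x px L.≈ x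

{-# OPTIONS --safe #-}
module Submission where

-- If 2 is invertible in K, then -1 ∈ L^× is a vector v with 2·v = v ⊕ v = (-1)² = 1,
-- the zero vector; so v = ½·(2·v) = ½·1 = 1, i.e. -1 = 1 in L.

open import Defs
open import Level using (Level)
open import Data.Sum using (_⊎_; inj₁; inj₂)
open import Data.Product using (_,_)
open import Data.Empty using (⊥-elim)
open import Relation.Nullary using (¬_)
import Algebra.Properties.Ring as RingProperties
import Relation.Binary.Reasoning.Setoid as SetoidReasoning

module FieldProperties {c ℓ : Level} (F : Field c ℓ) where
  open Field F
  open RingProperties ring
  open SetoidReasoning setoid

  1≉0 : ¬ (1# ≈ 0#)
  1≉0 1≈0 = 0≉1 (sym 1≈0)

  -1≉0 : ¬ (- 1# ≈ 0#)
  -1≉0 -1≈0 = 1≉0 (begin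
    1#      ≈⟨ -‿involutive 1# ⟨
    - - 1#  ≈⟨ -‿cong -1≈0 ⟩
    - 0#    ≈⟨ -0#≈0# ⟩
    0#      ∎)

  -1*-1≈1 : - 1# * - 1# ≈ 1#
  -1*-1≈1 = begin
    - 1# * - 1#  ≈⟨ -1*x≈-x (- 1#) ⟩
    - - 1#       ≈⟨ -‿involutive 1# ⟩
    1#           ∎

  -1≈1⇒charTwo : - 1# ≈ 1# → CharTwo F
  -1≈1⇒charTwo -1≈1 = begin
    1# + 1#    ≈⟨ +-congˡ -1≈1 ⟨
    1# + - 1#  ≈⟨ -‿inverseʳ 1# ⟩
    0#         ∎

  idempotent∧invertible⇒≈1 : ∀ {x y} → x * x ≈ x → x * y ≈ 1# → x ≈ 1#
  idempotent∧invertible⇒≈1 {x} {y} xx≈x xy≈1 = begin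
    x             ≈⟨ *-identityʳ x ⟨
    x * 1#        ≈⟨ *-congˡ xy≈1 ⟨
    x * (x * y)   ≈⟨ *-assoc x x y ⟨
    (x * x) * y   ≈⟨ *-congʳ xx≈x ⟩
    x * y         ≈⟨ xy≈1 ⟩
    1#            ∎

module MultGroupLinearSpaceProperties
    {c₁ ℓ₁ c₂ ℓ₂ : Level} {K : Field c₁ ℓ₁} {L : Field c₂ ℓ₂}
    (V : MultGroupLinearSpace K L) where
  private
    module K = Field K
    module L = Field L
  open MultGroupLinearSpace V
  open FieldProperties L
  open SetoidReasoning L.setoid

  1*1≉0 : ¬ (L.1# L.* L.1# L.≈ L.0#)
  1*1≉0 1*1≈0 = 1≉0 (L.trans (L.sym (L.*-identityˡ L.1#)) 1*1≈0)

  smul-1≈1 : ∀ a → smul a L.1# 1≉0 L.≈ L.1#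
  smul-1≈1 a with L.zero⊎inv (smul a L.1# 1≉0)
  ... | inj₁ s≈0 = ⊥-elim (smul-nz a L.1# 1≉0 s≈0)
  ... | inj₂ (_ , s*t≈1) = idempotent∧invertible⇒≈1 ss≈s s*t≈1
    where
    ss≈s : smul a L.1# 1≉0 L.* smul a L.1# 1≉0 L.≈ smul a L.1# 1≉0
    ss≈s = begin
      smul a L.1# 1≉0 L.* smul a L.1# 1≉0  ≈⟨ distrib-vec a L.1# L.1# 1≉0 1≉0 1*1≉0 ⟨
      smul a (L.1# L.* L.1#) 1*1≉0         ≈⟨ smul-cong 1*1≉0 1≉0 K.refl (L.*-identityˡ L.1#) ⟩
      smul a L.1# 1≉0                      ∎

  smul-2≈square : ∀ x (x≉0 : ¬ (x L.≈ L.0#)) → smul (K.1# K.+ K.1#) x x≉0 L.≈ x L.* x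
  smul-2≈square x x≉0 = begin
    smul (K.1# K.+ K.1#) x x≉0             ≈⟨ distrib-scal K.1# K.1# x x≉0 ⟩
    smul K.1# x x≉0 L.* smul K.1# x x≉0    ≈⟨ L.*-cong (identity x x≉0) (identity x x≉0) ⟩
    x L.* x                                ∎

  square≈1⇒≈1 : ∀ {h} → (K.1# K.+ K.1#) K.* h K.≈ K.1# →
                ∀ x (x≉0 : ¬ (x L.≈ L.0#)) → x L.* x L.≈ L.1# → x L.≈ L.1#
  square≈1⇒≈1 {h} 2h≈1 x x≉0 xx≈1 = begin
    x                                              ≈⟨ identity x x≉0 ⟨
    smul K.1# x x≉0                                ≈⟨ smul-cong x≉0 x≉0 h2≈1 L.refl ⟨
    smul (h K.* (K.1# K.+ K.1#)) x x≉0             ≈⟨ assoc h _ x x≉0 ⟩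
    smul h (smul (K.1# K.+ K.1#) x x≉0) 2x≉0       ≈⟨ smul-cong 2x≉0 1≉0 K.refl 2x≈1 ⟩
    smul h L.1# 1≉0                                ≈⟨ smul-1≈1 h ⟩
    L.1#                                           ∎
    where
    h2≈1 : h K.* (K.1# K.+ K.1#) K.≈ K.1#
    h2≈1 = K.trans (K.*-comm h _) 2h≈1
    2x≉0 : ¬ (smul (K.1# K.+ K.1#) x x≉0 L.≈ L.0#)
    2x≉0 = smul-nz (K.1# K.+ K.1#) x x≉0
    2x≈1 : smul (K.1# K.+ K.1#) x x≉0 L.≈ L.1#
    2x≈1 = L.trans (smul-2≈square x x≉0) xx≈1

lemma3p1 : ∀ {c₁ ℓ₁ c₂ ℓ₂} (K : Field c₁ ℓ₁) (L : Field c₂ ℓ₂) →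
    MultGroupLinearSpace K L → CharTwo K ⊎ CharTwo L
lemma3p1 K L V with Field.zero⊎inv K (Field._+_ K (Field.1# K) (Field.1# K))
... | inj₁ 2≈0 = inj₁ 2≈0
... | inj₂ (_ , 2h≈1) = inj₂ (-1≈1⇒charTwo -1≈1)
  where
  open Field L using (_≈_; -_; 1#)
  open FieldProperties L
  open MultGroupLinearSpaceProperties V
  -1≈1 : - 1# ≈ 1#
  -1≈1 = square≈1⇒≈1 2h≈1 _ -1≉0 -1*-1≈1
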